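{- Let $A[1,N]$ be an array of mutually distinct elements of a totally ordered set and let $\overleftrightarrow{A}:=[A[N],\ldots,A[1]]$ be its reversal. Then $(T[A])^*=T[\overleftrightarrow{A}]$, where nodes of both trees are identified via the array entries (the node $A[i]$ of $T[A]$ is identified with the node of $T[\overleftrightarrow{A}]$ carrying the same entry) and the roots are identified.
   Context: The 2D-Min-Heap $T[A]$ of an array $A[1,N]$ with distinct entries is the rooted ordered tree with node set $\{r\}\cup\{A[1],\ldots,A[N]\}$ (the root $r$ playing the role of $-\infty$), built by inserting $A[1],A[2],\ldots,A[N]$ in this order: $A[m+1]$ is appended as the new rightmost child of $A[k]$, where $k$ is the largest index $k\le m$ with $A[k]<A[m+1]$, or as the new rightmost child of $r$ if no such index exists (in particular $A[1]$ is a child of $r$). Dual tree: for a rooted ordered tree $T$ with root $r$, $T^*$ has the same vertex set and root $r$; with $rmc_T(u)$ the rightmost child and $ils_T(u)$ the immediate left sibling of $u$ in $T$, parents and sibling order in $T^*$ are given by: (1a) $r$ has no parent in $T^*$; (1b) if $v=rmc_T(r)$ then $v$ is the rightmost child of $r$ in $T^*$; (2) if $v=rmc_T(u)$ with $u\ne r$, then $v$ is the immediate left sibling of $u$ in $T^*$; (3) if $v=ils_T(u)$, then $v$ is the rightmost child of $u$ in $T^*$. Equality of trees means equal parent relation and equal order among siblings. -}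

module Defs where

open import Level using (Level)
open import Data.Nat using (ℕ)
open import Data.Fin using (Fin; opposite; _<?_) renaming (_≟_ to _≟ᶠ_)
open import Data.Maybe using (Maybe; just; nothing)
import Data.Maybe as Maybe
open import Data.List using (List; []; _∷_; _++_; [_]; last; reverse; filter; foldl; map)
open import Data.Maybe.Properties using (≡-dec)
open import Data.Product using (∃; ∃-syntax; _×_)
open import Relation.Binary.PropositionalEquality using (_≡_)
open import Relation.Nullary using (yes; no)
open import Relation.Binary.Bundles using (StrictTotalOrder)

allIdx : (n : ℕ) → List (Fin n)
allIdx n = Data.List.tabulate (λ i → i)

-- Nodes of a tree on an array of length N: `nothing` is the root r,
-- `just i` is the node carrying the entry A[i].
Node : ℕ → Set
Node N = Maybe (Fin N)

-- A rooted ordered tree on node set Node N with root `nothing`, given by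
-- the ordered (left-to-right) list of children of every node.
Tree : ℕ → Set
Tree N = Node N → List (Fin N)

RMC : ∀ {N} → Tree N → Node N → Fin N → Set
RMC T u v = last (T u) ≡ just v

ILS : ∀ {N} → Tree N → Fin N → Fin N → Set
ILS T v u = ∃[ p ] ∃[ xs ] ∃[ ys ] (T p ≡ xs ++ (v ∷ u ∷ ys))

-- S is the dual tree T* of T: conditions (1b), (2), (3) of the definition
-- ((1a) holds automatically: the root is never a child in this encoding).
IsDual : ∀ {N} → Tree N → Tree N → Set
IsDual T S =
    (∀ v → RMC T nothing v → RMC S nothing v)
  × (∀ u v → RMC T (just u) v → ILS S v u)
  × (∀ u v → ILS T v u → RMC S (just u) v)

module _ {a ℓ₁ ℓ₂ : Level} (O : StrictTotalOrder a ℓ₁ ℓ₂) where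
  open StrictTotalOrder O renaming (Carrier to C; _<?_ to _<ₒ?_)

  parentOf : ∀ {N} → (Fin N → C) → Fin N → Node N
  parentOf {N} A m = go (reverse (filter (_<? m) (allIdx N)))
    where
    go : List (Fin N) → Node N
    go [] = nothing
    go (k ∷ ks) with A k <ₒ? A m
    ... | yes _ = just k
    ... | no  _ = go ks

  appendChild : ∀ {N} → Node N → Fin N → Tree N → Tree N
  appendChild p m T u with ≡-dec _≟ᶠ_ u p
  ... | yes _ = T u ++ [ m ]
  ... | no  _ = T u

  minHeap : ∀ {N} → (Fin N → C) → Tree N
  minHeap {N} A = foldl (λ T m → appendChild (parentOf A m) m T) (λ _ → []) (allIdx N)

reverseArr : ∀ {b} {B : Set b} {N} → (Fin N → B) → (Fin N → B)
reverseArr A i = A (opposite i)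

-- transport a tree on the nodes of the reversed array to the nodes of the
-- original array: node i of the reversed array carries entry A[opposite i].
relabel : ∀ {N} → Tree N → Tree N
relabel S u = map opposite (S (Maybe.map opposite u))

-- In T[A] the parent of A[m] is its previous smaller value: the nearest index k < m with
-- A[k] < A[m], or the root if there is none; child lists are in increasing index order.
-- Symmetrically, T[reversed A], read on the indices of A, is the tree of next smaller values
-- with child lists in decreasing index order. The three clauses of the dual then become
-- facts about these two relations. The last root child of T[A] is the minimum of A. If v is
-- the last child of u, then u and v have the same next smaller value. If v < u are consecutive
-- siblings, then u is the next smaller value of v: an entry between them that is smaller than
-- A[v] would have an ancestor strictly between them that is also a sibling.
module Submission where

open import Defs
open import Data.Nat using (ℕ; s≤s)
import Data.Nat as ℕ
import Data.Nat.Properties as ℕₚ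
open import Data.Fin using (Fin; opposite; _<_; _≤_; _<?_) renaming (_≟_ to _≟ᶠ_)
open import Data.Fin.Properties
  using (<-cmp; <-irrefl; <-asym; <-trans; <⇒≢; ≤-refl; ≤-trans; toℕ<n; opposite-involutive; opposite-prop)
open import Data.Fin.Induction using (<-wellFounded)
open import Induction.WellFounded using (Acc; acc)
open import Data.Maybe using (Maybe; just; nothing)
import Data.Maybe as Maybe
open import Data.Maybe.Relation.Unary.All using (just; nothing) renaming (All to Maybe-All)
open import Data.Maybe.Properties using (≡-dec)
open import Data.List using (List; []; _∷_; _++_; [_]; last; reverse; filter; foldl)
open import Data.List.Properties using (unfold-reverse; ++-assoc; ++-identityʳ)
open import Data.List.Membership.Propositional using (_∈_)
open import Data.List.Membership.Propositional.Properties
  using (∈-++⁺ʳ; ∈-filter⁺; ∈-filter⁻; ∈-tabulate⁺; ∈-map⁺; ∈-map⁻)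
open import Data.List.Relation.Unary.Any using (here; there)
open import Data.List.Relation.Unary.Any.Properties using (reverse⁺; reverse⁻)
open import Data.List.Relation.Unary.All as All using ([]; _∷_)
open import Data.List.Relation.Unary.AllPairs using (AllPairs; []; _∷_) renaming (map to AllPairs-map)
import Data.List.Relation.Unary.AllPairs.Properties as AllPairs
open import Data.Product using (∃; ∃₂; _×_; _,_; proj₂)
open import Data.Empty using (⊥; ⊥-elim)
open import Function using (id; _∘_; flip)
open import Relation.Nullary using (¬_; Dec; yes; no)
open import Relation.Binary using (Rel; Asymmetric; tri<; tri≈; tri>)
open import Relation.Binary.Bundles using (StrictTotalOrder)
open import Function.Definitions using (Injective)
open import Relation.Binary.PropositionalEquality
  using (_≡_; _≢_; refl; sym; cong; subst; subst₂; module ≡-Reasoning)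
open ≡-Reasoning

allIdx-sorted : ∀ {n} → AllPairs _<_ (allIdx n)
allIdx-sorted = AllPairs.tabulate⁺-< id

AllPairs-reverse⁺ : ∀ {a r} {A : Set a} {R : Rel A r} {xs} →
                    AllPairs R xs → AllPairs (flip R) (reverse xs)
AllPairs-reverse⁺ [] = []
AllPairs-reverse⁺ {R = R} {x ∷ xs} (x<xs ∷ sorted) =
  subst (AllPairs (flip R)) (sym (unfold-reverse x xs))
    (AllPairs.++⁺ (AllPairs-reverse⁺ sorted) ([] ∷ [])
      (All.tabulate (λ y∈ → All.lookup x<xs (reverse⁻ y∈) ∷ [])))

module SortedLists {a r} {A : Set a} {R : Rel A r} (R-asym : Asymmetric R) where

  private
    R-irrefl : ∀ {x} → ¬ R x x
    R-irrefl r = R-asym r r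

  Adjacent : List A → A → A → Set a
  Adjacent xs v u = ∃₂ λ as bs → xs ≡ as ++ v ∷ u ∷ bs

  sorted-last⁻ : ∀ {xs v} → AllPairs R xs → last xs ≡ just v →
                 v ∈ xs × (∀ {w} → w ∈ xs → ¬ R v w)
  sorted-last⁻ {x ∷ []} _ refl = here refl , λ { (here refl) → R-irrefl }
  sorted-last⁻ {x ∷ y ∷ ys} (x<ys ∷ sorted) last≡v with sorted-last⁻ sorted last≡v
  ... | v∈ , maximal = there v∈ , λ
    { (here refl) vRx → R-asym vRx (All.lookup x<ys v∈)
    ; (there w∈) → maximal w∈ }

  sorted-last⁺ : ∀ {xs v} → AllPairs R xs → v ∈ xs → (∀ {w} → w ∈ xs → ¬ R v w) →
                 last xs ≡ just v
  sorted-last⁺ {x ∷ []} _ (here refl) _ = refl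
  sorted-last⁺ {x ∷ y ∷ ys} (x<ys ∷ _) (here refl) maximal =
    ⊥-elim (maximal (there (here refl)) (All.lookup x<ys (here refl)))
  sorted-last⁺ {x ∷ y ∷ ys} (_ ∷ sorted) (there v∈) maximal =
    sorted-last⁺ sorted v∈ (maximal ∘ there)

  sorted-adjacent⁻ : ∀ as {v u bs} → AllPairs R (as ++ v ∷ u ∷ bs) →
                     R v u × (∀ {w} → w ∈ as ++ v ∷ u ∷ bs → R v w → ¬ R w u)
  sorted-adjacent⁻ [] ((vRu ∷ _) ∷ (u<bs ∷ _)) = vRu , λ
    { (here refl) vRv _ → R-irrefl vRv
    ; (there (here refl)) _ uRu → R-irrefl uRu
    ; (there (there w∈)) _ wRu → R-asym (All.lookup u<bs w∈) wRu }
  sorted-adjacent⁻ (x ∷ as) (x<rest ∷ sorted) with sorted-adjacent⁻ as sorted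
  ... | vRu , between = vRu , λ
    { (here refl) vRx _ → R-asym vRx (All.lookup x<rest (∈-++⁺ʳ as (here refl)))
    ; (there w∈) → between w∈ }

  sorted-adjacent⁺ : ∀ {xs v u} → AllPairs R xs → v ∈ xs → u ∈ xs → R v u →
                     (∀ {w} → w ∈ xs → R v w → ¬ R w u) → Adjacent xs v u
  sorted-adjacent⁺ (_ ∷ _) (here refl) (here refl) vRv _ = ⊥-elim (R-irrefl vRv)
  sorted-adjacent⁺ {x ∷ xs} (x<xs ∷ _) (there v∈) (here refl) vRx _ =
    ⊥-elim (R-asym vRx (All.lookup x<xs v∈))
  sorted-adjacent⁺ {x ∷ y ∷ ys} (_ ∷ _) (here refl) (there (here refl)) _ _ = [] , ys , refl
  sorted-adjacent⁺ {x ∷ y ∷ ys} (x<xs ∷ (y<ys ∷ _)) (here refl) (there (there u∈)) _ between =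
    ⊥-elim (between (there (here refl)) (All.lookup x<xs (here refl)) (All.lookup y<ys u∈))
  sorted-adjacent⁺ {x ∷ xs} (_ ∷ sorted) (there v∈) (there u∈) vRu between
    with sorted-adjacent⁺ sorted v∈ u∈ vRu (between ∘ there)
  ... | as , bs , xs≡ = x ∷ as , bs , cong (x ∷_) xs≡

opposite-reverses-< : ∀ {n} {i j : Fin n} → i < j → opposite j < opposite i
opposite-reverses-< {i = i} {j} i<j = subst₂ ℕ._<_ (sym (opposite-prop j)) (sym (opposite-prop i))
  (ℕₚ.∸-monoʳ-< (s≤s i<j) (toℕ<n j))

opposite-<-swap : ∀ {n} {i j : Fin n} → opposite i < j → opposite j < i
opposite-<-swap {i = i} i′<j = subst (_ <_) (opposite-involutive i) (opposite-reverses-< i′<j)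

<-opposite-swap : ∀ {n} {i j : Fin n} → i < opposite j → j < opposite i
<-opposite-swap {j = j} i<j′ = subst (_< _) (opposite-involutive j) (opposite-reverses-< i<j′)

map-opposite-involutive : ∀ {n} (p : Maybe (Fin n)) → Maybe.map opposite (Maybe.map opposite p) ≡ p
map-opposite-involutive nothing  = refl
map-opposite-involutive (just k) = cong just (opposite-involutive k)

module _ {a ℓ₁ ℓ₂} (O : StrictTotalOrder a ℓ₁ ℓ₂) {N : ℕ} where
  open StrictTotalOrder O using (_≈_; compare)
    renaming (Carrier to C; _<_ to _⊏_; _<?_ to _⊏?_; trans to ⊏-trans; asym to ⊏-asym)

  PrevSmaller : (Fin N → C) → Fin N → Node N → Set ℓ₂
  PrevSmaller X m nothing  = ∀ j → j < m → ¬ X j ⊏ X m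
  PrevSmaller X m (just k) = k < m × X k ⊏ X m × (∀ j → k < j → j < m → ¬ X j ⊏ X m)

  NextSmaller : (Fin N → C) → Fin N → Node N → Set ℓ₂
  NextSmaller X m nothing  = ∀ j → m < j → ¬ X j ⊏ X m
  NextSmaller X m (just k) = m < k × X k ⊏ X m × (∀ j → m < j → j < k → ¬ X j ⊏ X m)

  prevSmaller-unique : ∀ {X m p q} → PrevSmaller X m p → PrevSmaller X m q → p ≡ q
  prevSmaller-unique {p = nothing} {nothing}  _ _ = refl
  prevSmaller-unique {p = nothing} {just k} none (k<m , Xk⊏Xm , _) = ⊥-elim (none k k<m Xk⊏Xm)
  prevSmaller-unique {p = just k} {nothing} (k<m , Xk⊏Xm , _) none = ⊥-elim (none k k<m Xk⊏Xm)
  prevSmaller-unique {p = just k} {just l} (k<m , Xk⊏Xm , gapₖ) (l<m , Xl⊏Xm , gapₗ) with <-cmp k l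
  ... | tri< k<l _ _ = ⊥-elim (gapₖ l k<l l<m Xl⊏Xm)
  ... | tri≈ _ k≡l _ = cong just k≡l
  ... | tri> _ _ l<k = ⊥-elim (gapₗ k l<k k<m Xk⊏Xm)

  module Search (X : Fin N → C) (m : Fin N) where

    candidates : List (Fin N)
    candidates = reverse (filter (_<? m) (allIdx N))

    -- The scan `go` in parentOf is local and cannot be named; `search` is a
    -- metavariable that the with-abstracted goal of parentOf≡search solves to it.
    mutual
      search : List (Fin N) → Node N
      search = _

      parentOf≡search : parentOf O X m ≡ search candidates
      parentOf≡search with candidates
      ... | ks = refl

    search-prevSmaller : ∀ ks → AllPairs (flip _<_) ks → (∀ {k} → k ∈ ks → k < m) →
                         (∀ j → j < m → X j ⊏ X m → j ∈ ks) → PrevSmaller X m (search ks)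
    search-prevSmaller [] _ _ complete j j<m Xj⊏Xm with complete j j<m Xj⊏Xm
    ... | ()
    search-prevSmaller (k ∷ ks) (k>ks ∷ sorted) bounded complete with X k ⊏? X m
    ... | yes Xk⊏Xm = bounded (here refl) , Xk⊏Xm , gap
      where
      gap : ∀ j → k < j → j < m → ¬ X j ⊏ X m
      gap j k<j j<m Xj⊏Xm with complete j j<m Xj⊏Xm
      ... | here refl = <-irrefl refl k<j
      ... | there j∈ = <-asym k<j (All.lookup k>ks j∈)
    ... | no Xk⋢Xm = search-prevSmaller ks sorted (bounded ∘ there) complete′
      where
      complete′ : ∀ j → j < m → X j ⊏ X m → j ∈ ks
      complete′ j j<m Xj⊏Xm with complete j j<m Xj⊏Xm
      ... | here refl = ⊥-elim (Xk⋢Xm Xj⊏Xm)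
      ... | there j∈ = j∈

    parentOf-prevSmaller : PrevSmaller X m (parentOf O X m)
    parentOf-prevSmaller = subst (PrevSmaller X m) (sym parentOf≡search)
      (search-prevSmaller candidates
        (AllPairs-reverse⁺ (AllPairs.filter⁺ (_<? m) allIdx-sorted))
        (λ k∈ → proj₂ (∈-filter⁻ (_<? m) {xs = allIdx N} (reverse⁻ k∈)))
        (λ j j<m _ → reverse⁺ (∈-filter⁺ (_<? m) (∈-tabulate⁺ j) j<m)))

  open Search using (parentOf-prevSmaller)

  _≟ᴺ_ : (u w : Node N) → Dec (u ≡ w)
  _≟ᴺ_ = ≡-dec _≟ᶠ_

  insertAll-children : (parent : Fin N → Node N) (ms : List (Fin N)) (T : Tree N) (u : Node N) →
    foldl (λ T m → appendChild O (parent m) m T) T ms u ≡ T u ++ filter (λ m → u ≟ᴺ parent m) ms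
  insertAll-children parent [] T u = sym (++-identityʳ (T u))
  insertAll-children parent (m ∷ ms) T u = begin
    foldl insert (appendChild O (parent m) m T) ms u    ≡⟨ insertAll-children parent ms _ u ⟩
    appendChild O (parent m) m T u ++ filter isChild ms ≡⟨ appendChild-++ ⟩
    T u ++ filter isChild (m ∷ ms)                      ∎
    where
    insert : Tree N → Fin N → Tree N
    insert T m = appendChild O (parent m) m T
    isChild : (m : Fin N) → Dec (u ≡ parent m)
    isChild m = u ≟ᴺ parent m
    appendChild-++ : appendChild O (parent m) m T u ++ filter isChild ms ≡
                     T u ++ filter isChild (m ∷ ms)
    appendChild-++ with u ≟ᴺ parent m
    ... | yes _ = ++-assoc (T u) [ m ] (filter isChild ms)
    ... | no _  = refl

  minHeap-children : ∀ X u → minHeap O X u ≡ filter (λ m → u ≟ᴺ parentOf O X m) (allIdx N)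
  minHeap-children X = insertAll-children (parentOf O X) (allIdx N) (λ _ → [])

  minHeap-sorted : ∀ X u → AllPairs _<_ (minHeap O X u)
  minHeap-sorted X u = subst (AllPairs _<_) (sym (minHeap-children X u))
    (AllPairs.filter⁺ (λ m → u ≟ᴺ parentOf O X m) allIdx-sorted)

  ∈-minHeap⁻ : ∀ {X u m} → m ∈ minHeap O X u → PrevSmaller X m u
  ∈-minHeap⁻ {X} {u} {m} m∈ with ∈-filter⁻ (λ m → u ≟ᴺ parentOf O X m) {xs = allIdx N}
                                    (subst (m ∈_) (minHeap-children X u) m∈)
  ... | _ , u≡parent = subst (PrevSmaller X m) (sym u≡parent) (parentOf-prevSmaller X m)

  ∈-minHeap⁺ : ∀ {X u m} → PrevSmaller X m u → m ∈ minHeap O X u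
  ∈-minHeap⁺ {X} {u} {m} prev = subst (m ∈_) (sym (minHeap-children X u))
    (∈-filter⁺ (λ m → u ≟ᴺ parentOf O X m) (∈-tabulate⁺ m)
      (prevSmaller-unique prev (parentOf-prevSmaller X m)))

  -- A prime marks an index reflected by `opposite`.
  module _ (X : Fin N → C) where

    private
      reverseArr-opposite : ∀ i → reverseArr X (opposite i) ≡ X i
      reverseArr-opposite i = cong X (opposite-involutive i)

    prevSmaller-reverse : ∀ {m} u → PrevSmaller (reverseArr X) m (Maybe.map opposite u) →
                          NextSmaller X (opposite m) u
    prevSmaller-reverse {m} nothing none j m′<j Xj⊏Xm′ =
      none (opposite j) (opposite-<-swap m′<j)
        (subst (_⊏ X (opposite m)) (sym (reverseArr-opposite j)) Xj⊏Xm′)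
    prevSmaller-reverse {m} (just k) (k′<m , Xk″⊏Xm′ , gap) =
      opposite-<-swap k′<m , subst (_⊏ X (opposite m)) (reverseArr-opposite k) Xk″⊏Xm′ ,
      λ j m′<j j<k Xj⊏Xm′ → gap (opposite j) (opposite-reverses-< j<k) (opposite-<-swap m′<j)
        (subst (_⊏ X (opposite m)) (sym (reverseArr-opposite j)) Xj⊏Xm′)

    nextSmaller-reverse : ∀ {x} u → NextSmaller X x u →
                          PrevSmaller (reverseArr X) (opposite x) (Maybe.map opposite u)
    nextSmaller-reverse {x} nothing none j j<x′ =
      none (opposite j) (<-opposite-swap j<x′) ∘ subst (X (opposite j) ⊏_) (reverseArr-opposite x)
    nextSmaller-reverse {x} (just k) (x<k , Xk⊏Xx , gap) =
      opposite-reverses-< x<k ,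
      subst₂ _⊏_ (sym (reverseArr-opposite k)) (sym (reverseArr-opposite x)) Xk⊏Xx ,
      λ j k′<j j<x′ → gap (opposite j) (<-opposite-swap j<x′) (opposite-<-swap k′<j)
        ∘ subst (X (opposite j) ⊏_) (reverseArr-opposite x)

  Dual : (Fin N → C) → Tree N
  Dual X = relabel (minHeap O (reverseArr X))

  dual-sorted : ∀ X u → AllPairs (flip _<_) (Dual X u)
  dual-sorted X u = AllPairs.map⁺
    (AllPairs-map opposite-reverses-< (minHeap-sorted (reverseArr X) (Maybe.map opposite u)))

  ∈-dual⁻ : ∀ {X u x} → x ∈ Dual X u → NextSmaller X x u
  ∈-dual⁻ {X} {u} x∈ with ∈-map⁻ opposite x∈
  ... | m , m∈ , refl = prevSmaller-reverse X u (∈-minHeap⁻ m∈)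

  ∈-dual⁺ : ∀ {X u x} → NextSmaller X x u → x ∈ Dual X u
  ∈-dual⁺ {X} {u} {x} next =
    subst (_∈ _) (opposite-involutive x)
      (∈-map⁺ opposite (∈-minHeap⁺ (nextSmaller-reverse X u next)))

  nextSmaller-exists : ∀ X x → ∃ (NextSmaller X x)
  nextSmaller-exists X x = u , subst (λ i → NextSmaller X i u) (opposite-involutive x)
    (prevSmaller-reverse X u (subst (PrevSmaller (reverseArr X) (opposite x))
      (sym (map-opposite-involutive q)) (parentOf-prevSmaller (reverseArr X) (opposite x))))
    where
    q u : Node N
    q = parentOf O (reverseArr X) (opposite x)
    u = Maybe.map opposite q

  open SortedLists {A = Fin N} {R = _<_} <-asym using (sorted-last⁻; sorted-adjacent⁻)
  open SortedLists {A = Fin N} {R = flip _<_} <-asym using (sorted-last⁺; sorted-adjacent⁺)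

  rmc-minHeap⁻ : ∀ {X u v} → RMC (minHeap O X) u v →
                 PrevSmaller X v u × (∀ {w} → PrevSmaller X w u → ¬ v < w)
  rmc-minHeap⁻ {X} {u} rmc with sorted-last⁻ (minHeap-sorted X u) rmc
  ... | v∈ , maximal = ∈-minHeap⁻ v∈ , maximal ∘ ∈-minHeap⁺

  ils-minHeap⁻ : ∀ {X u v} → ILS (minHeap O X) v u →
                 ∃ λ p → PrevSmaller X v p × PrevSmaller X u p × v < u ×
                         (∀ {w} → PrevSmaller X w p → v < w → ¬ w < u)
  ils-minHeap⁻ {X} (p , as , bs , children≡)
    with sorted-adjacent⁻ as (subst (AllPairs _<_) children≡ (minHeap-sorted X p))
  ... | v<u , between =
    p , ∈-minHeap⁻ (child (∈-++⁺ʳ as (here refl))) ,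
    ∈-minHeap⁻ (child (∈-++⁺ʳ as (there (here refl)))) , v<u , λ prevʷ → between (subst (_ ∈_) children≡ (∈-minHeap⁺ prevʷ))
    where
    child : ∀ {x} → x ∈ as ++ _ ∷ _ ∷ bs → x ∈ minHeap O X p
    child = subst (_ ∈_) (sym children≡)

  rmc-dual⁺ : ∀ {X u v} → NextSmaller X v u → (∀ {w} → NextSmaller X w u → ¬ w < v) →
              RMC (Dual X) u v
  rmc-dual⁺ {X} {u} next least =
    sorted-last⁺ (dual-sorted X u) (∈-dual⁺ next) (least ∘ ∈-dual⁻)

  ils-dual⁺ : ∀ {X u v p} → NextSmaller X v p → NextSmaller X u p → u < v →
              (∀ {w} → NextSmaller X w p → w < v → ¬ u < w) → ILS (Dual X) v u
  ils-dual⁺ {X} {p = p} nextᵥ nextᵤ u<v between =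
    p , sorted-adjacent⁺ (dual-sorted X p) (∈-dual⁺ nextᵥ) (∈-dual⁺ nextᵤ) u<v
          (between ∘ ∈-dual⁻)

  module _ (A : Fin N → C) (A-injective : Injective _≡_ _≈_ A) where

    ⋢⇒⊐ : ∀ {i j} → i ≢ j → ¬ A i ⊏ A j → A j ⊏ A i
    ⋢⇒⊐ {i} {j} i≢j Ai⋢Aj with compare (A i) (A j)
    ... | tri< Ai⊏Aj _ _ = ⊥-elim (Ai⋢Aj Ai⊏Aj)
    ... | tri≈ _ Ai≈Aj _ = ⊥-elim (i≢j (A-injective Ai≈Aj))
    ... | tri> _ _ Aj⊏Ai = Aj⊏Ai

    siblings-⊐ : ∀ {p v u} → PrevSmaller A v p → PrevSmaller A u p → v < u → A u ⊏ A v
    siblings-⊐ {nothing} _ rootᵤ v<u = ⋢⇒⊐ (<⇒≢ v<u) (rootᵤ _ v<u)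
    siblings-⊐ {just k} (k<v , _) (_ , _ , gapᵤ) v<u = ⋢⇒⊐ (<⇒≢ v<u) (gapᵤ _ k<v v<u)

    parent-⊏-between : ∀ {p v u j} → PrevSmaller A v p → PrevSmaller A u p → v < j → j < u →
                       Maybe-All (λ k → A k ⊏ A j) p
    parent-⊏-between {nothing} _ _ _ _ = nothing
    parent-⊏-between {just k} (k<v , _) (_ , Ak⊏Au , gapᵤ) v<j j<u =
      just (⊏-trans Ak⊏Au (⋢⇒⊐ (<⇒≢ j<u) (gapᵤ _ (<-trans k<v v<j) j<u)))

    left-parent-≡ : ∀ {p q v i} → PrevSmaller A v p → PrevSmaller A i q → v < i → A i ⊏ A v →
                    Maybe-All (λ k → A k ⊏ A i) p → Maybe-All (_< v) q → q ≡ p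
    left-parent-≡ {nothing} {nothing} _ _ _ _ _ _ = refl
    left-parent-≡ {nothing} {just k′} rootᵥ (_ , Ak′⊏Ai , _) _ Ai⊏Av _ (just k′<v) =
      ⊥-elim (rootᵥ k′ k′<v (⊏-trans Ak′⊏Ai Ai⊏Av))
    left-parent-≡ {just k} {nothing} (k<v , _) rootᵢ v<i _ (just Ak⊏Ai) _ =
      ⊥-elim (rootᵢ k (<-trans k<v v<i) Ak⊏Ai)
    left-parent-≡ {just k} {just k′} (k<v , _ , gapᵥ) (_ , Ak′⊏Ai , gapᵢ) v<i Ai⊏Av
                  (just Ak⊏Ai) (just k′<v) with <-cmp k′ k
    ... | tri< k′<k _ _ = ⊥-elim (gapᵢ k k′<k (<-trans k<v v<i) Ak⊏Ai)
    ... | tri≈ _ k′≡k _ = cong just k′≡k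
    ... | tri> _ _ k<k′ = ⊥-elim (gapᵥ k′ k<k′ k′<v (⊏-trans Ak′⊏Ai Ai⊏Av))

    -- Climbing from i towards the root along parents stays right of v until it
    -- meets a child of p; the hypothesis on p rules out passing p itself.
    sibling-ancestor : ∀ {p v} → PrevSmaller A v p → ∀ i → Acc _<_ i → v < i → A i ⊏ A v →
                       (∀ j → v < j → j ≤ i → Maybe-All (λ k → A k ⊏ A j) p) →
                       ∃ λ w → PrevSmaller A w p × v < w × w ≤ i
    sibling-ancestor {p} {v} prevᵥ i (acc rec) v<i Ai⊏Av ⊏between =
      climb (parentOf O A i) (parentOf-prevSmaller A i)
      where
      sibling : ∀ {q} → PrevSmaller A i q → Maybe-All (_< v) q →
                ∃ λ w → PrevSmaller A w p × v < w × w ≤ i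
      sibling prevᵢ q<v = i , subst (PrevSmaller A i) q≡p prevᵢ , v<i , ≤-refl
        where q≡p = left-parent-≡ prevᵥ prevᵢ v<i Ai⊏Av (⊏between i v<i ≤-refl) q<v
      climb : ∀ q → PrevSmaller A i q → ∃ λ w → PrevSmaller A w p × v < w × w ≤ i
      climb nothing rootᵢ = sibling rootᵢ nothing
      climb (just k′) prevᵢ@(k′<i , Ak′⊏Ai , _) with <-cmp k′ v
      ... | tri< k′<v _ _ = sibling prevᵢ (just k′<v)
      ... | tri≈ _ refl _ = ⊥-elim (⊏-asym Ak′⊏Ai Ai⊏Av)
      ... | tri> _ _ v<k′
        with sibling-ancestor prevᵥ k′ (rec k′<i) v<k′ (⊏-trans Ak′⊏Ai Ai⊏Av)
               (λ j v<j j≤k′ → ⊏between j v<j (≤-trans j≤k′ (ℕₚ.<⇒≤ k′<i)))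
      ...   | w , prevʷ , v<w , w≤k′ = w , prevʷ , v<w , ≤-trans w≤k′ (ℕₚ.<⇒≤ k′<i)

    lastRoot-nextSmaller : ∀ {v} → PrevSmaller A v nothing →
                           (∀ {w} → PrevSmaller A w nothing → ¬ v < w) → NextSmaller A v nothing
    lastRoot-nextSmaller rootᵥ last j v<j Aj⊏Av
      with sibling-ancestor rootᵥ j (<-wellFounded j) v<j Aj⊏Av (λ _ _ _ → nothing)
    ... | w , rootʷ , v<w , _ = last rootʷ v<w

    root-nextSmaller-least : ∀ {v w} → PrevSmaller A v nothing → NextSmaller A w nothing → ¬ w < v
    root-nextSmaller-least rootᵥ rootʷ w<v = rootʷ _ w<v (⋢⇒⊐ (<⇒≢ w<v) (rootᵥ _ w<v))

    lastChild-nextSmaller : ∀ {u v p} → PrevSmaller A v (just u) →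
                            (∀ {w} → PrevSmaller A w (just u) → ¬ v < w) →
                            NextSmaller A v p → NextSmaller A u p
    lastChild-nextSmaller {u} {v} (u<v , Au⊏Av , gapᵥ) last = lift
      where
      beyond : ∀ {j} → u < j → A j ⊏ A v → v < j
      beyond {j} u<j Aj⊏Av with <-cmp j v
      ... | tri< j<v _ _ = ⊥-elim (gapᵥ j u<j j<v Aj⊏Av)
      ... | tri≈ _ refl _ = ⊥-elim (⊏-asym Aj⊏Av Aj⊏Av)
      ... | tri> _ _ v<j = v<j
      lift : ∀ {p} → NextSmaller A v p → NextSmaller A u p
      lift {nothing} rootᵥ j u<j Aj⊏Au = rootᵥ j (beyond u<j Aj⊏Av) Aj⊏Av
        where Aj⊏Av = ⊏-trans Aj⊏Au Au⊏Av
      lift {just k} (v<k , Ak⊏Av , gapᵥ′) = u<k , Ak⊏Au , λ j u<j j<k Aj⊏Au →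
        let Aj⊏Av = ⊏-trans Aj⊏Au Au⊏Av in gapᵥ′ j (beyond u<j Aj⊏Av) j<k Aj⊏Av
        where
        u<k = <-trans u<v v<k
        -- otherwise k would be a child of u to the right of v
        Ak⊏Au : A k ⊏ A u
        Ak⊏Au = ⋢⇒⊐ (<⇒≢ u<k) λ Au⊏Ak → last (u<k , Au⊏Ak , λ j u<j j<k Aj⊏Ak →
          let Aj⊏Av = ⊏-trans Aj⊏Ak Ak⊏Av in gapᵥ′ j (beyond u<j Aj⊏Av) j<k Aj⊏Av) v<k

    lastChild-between : ∀ {u v w p} → PrevSmaller A v (just u) → NextSmaller A v p →
                        NextSmaller A w p → w < v → ¬ u < w
    lastChild-between {p = nothing} (_ , _ , gapᵥ) _ rootʷ w<v u<w =
      rootʷ _ w<v (⋢⇒⊐ (<⇒≢ w<v) (gapᵥ _ u<w w<v))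
    lastChild-between {p = just k} (_ , _ , gapᵥ) (v<k , _) (_ , _ , gapʷ) w<v u<w =
      gapʷ _ w<v v<k (⋢⇒⊐ (<⇒≢ w<v) (gapᵥ _ u<w w<v))

    siblings-nextSmaller : ∀ {p v u} → PrevSmaller A v p → PrevSmaller A u p → v < u →
                           (∀ {w} → PrevSmaller A w p → v < w → ¬ w < u) →
                           NextSmaller A v (just u)
    siblings-nextSmaller {v = v} {u} prevᵥ prevᵤ v<u between =
      v<u , siblings-⊐ prevᵥ prevᵤ v<u , none-smaller
      where
      none-smaller : ∀ i → v < i → i < u → ¬ A i ⊏ A v
      none-smaller i v<i i<u Ai⊏Av
        with sibling-ancestor prevᵥ i (<-wellFounded i) v<i Ai⊏Av
               (λ j v<j j≤i → parent-⊏-between prevᵥ prevᵤ v<j (ℕₚ.≤-<-trans j≤i i<u))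
      ... | w , prevʷ , v<w , w≤i = between prevʷ v<w (ℕₚ.≤-<-trans w≤i i<u)

    siblings-nextSmaller-least : ∀ {p v u w} → PrevSmaller A v p → PrevSmaller A u p → v < u →
                                 NextSmaller A w (just u) → ¬ w < v
    siblings-nextSmaller-least {p} {v} {u} {w} prevᵥ prevᵤ v<u (_ , Au⊏Aw , gapʷ) w<v =
      beside p prevᵥ prevᵤ
      where
      Aw⊏Av : A w ⊏ A v
      Aw⊏Av = ⋢⇒⊐ (<⇒≢ w<v ∘ sym) (gapʷ v w<v v<u)
      beside : ∀ p → PrevSmaller A v p → PrevSmaller A u p → ⊥
      beside nothing rootᵥ _ = rootᵥ w w<v Aw⊏Av
      beside (just k) (k<v , _ , gapᵥ) (_ , Ak⊏Au , _) with <-cmp w k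
      ... | tri< w<k _ _ = gapʷ k w<k (<-trans k<v v<u) (⊏-trans Ak⊏Au Au⊏Aw)
      ... | tri≈ _ refl _ = ⊏-asym Ak⊏Au Au⊏Aw
      ... | tri> _ _ k<w = gapᵥ w k<w w<v Aw⊏Av

    dual-root : ∀ v → RMC (minHeap O A) nothing v → RMC (Dual A) nothing v
    dual-root v rmc with rmc-minHeap⁻ rmc
    ... | rootᵥ , last = rmc-dual⁺ (lastRoot-nextSmaller rootᵥ last) (root-nextSmaller-least rootᵥ)

    dual-rmc : ∀ u v → RMC (minHeap O A) (just u) v → ILS (Dual A) v u
    dual-rmc u v rmc with rmc-minHeap⁻ rmc | nextSmaller-exists A v
    ... | childᵥ@(u<v , _) , last | p , nextᵥ =
      ils-dual⁺ nextᵥ (lastChild-nextSmaller childᵥ last nextᵥ) u<v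
        (lastChild-between childᵥ nextᵥ)

    dual-ils : ∀ u v → ILS (minHeap O A) v u → RMC (Dual A) (just u) v
    dual-ils u v ils with ils-minHeap⁻ ils
    ... | p , prevᵥ , prevᵤ , v<u , between =
      rmc-dual⁺ (siblings-nextSmaller prevᵥ prevᵤ v<u between)
        (siblings-nextSmaller-least prevᵥ prevᵤ v<u)

theorem3 : ∀ {a ℓ₁ ℓ₂} (O : StrictTotalOrder a ℓ₁ ℓ₂) (N : ℕ) (A : Fin N → StrictTotalOrder.Carrier O)
           → Injective _≡_ (StrictTotalOrder._≈_ O) A
           → IsDual (minHeap O A) (relabel (minHeap O (reverseArr A)))
theorem3 O N A A-injective =
  dual-root O A A-injective , dual-rmc O A A-injective , dual-ils O A A-injective
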